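{- Let $k\geq 1$ be an integer and let $G$ be a nontrivial connected graph with maximum degree $\Delta(G)\ge k$. Then $i_{[kR]}(G)\ge \dfrac{|V(G)|(k+1)}{\Delta(G)+1}$.
   Context: All graphs are finite and simple; nontrivial means at least two vertices. For $f\colon V(G)\to\mathbb{Z}_{\ge 0}$ and $S\subseteq V(G)$, $f(S)=\sum_{v\in S}f(v)$, and $AN(v)=\{w\in N(v): f(w)\ge 1\}$. A $[k]$-Roman dominating function of $G$ is a function $f\colon V(G)\to\{0,1,\ldots,k+1\}$ such that $f(N[v])\ge k+|AN(v)|$ for every vertex $v$ with $f(v)<k$; its weight is $f(V(G))$. $i_{[kR]}(G)$ is the minimum weight of such a function whose set of vertices with positive label is independent. -}

module Defs where

open import Data.Nat using (ℕ; zero; suc; _+_; _*_; _≤_; _<_)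
open import Data.Bool using (Bool; true; false; if_then_else_; T)
open import Data.Fin using (Fin)
open import Data.List using (List; []; _∷_; map; allFin)
open import Data.Nat.ListAction using (sum)
open import Data.Product using (Σ; _×_; ∃)
open import Relation.Binary.PropositionalEquality using (_≡_)
open import Relation.Nullary using (¬_)

record Graph (n : ℕ) : Set where
  field
    adj     : Fin n → Fin n → Bool
    sym     : ∀ u v → adj u v ≡ adj v u
    irrefl  : ∀ v → adj v v ≡ false
open Graph public

Σv : ∀ {n} → (Fin n → ℕ) → ℕ
Σv {n} g = sum (map g (allFin n))

deg : ∀ {n} → Graph n → Fin n → ℕ
deg G v = Σv (λ w → if adj G v w then 1 else 0)

IsMaxDegree : ∀ {n} → Graph n → ℕ → Set
IsMaxDegree {n} G D = (∀ v → deg G v ≤ D) × ∃ (λ v → deg G v ≡ D)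

data Walk {n} (G : Graph n) : Fin n → Fin n → Set where
  here : ∀ {v} → Walk G v v
  step : ∀ {u v w} → T (adj G u v) → Walk G v w → Walk G u w

Connected : ∀ {n} → Graph n → Set
Connected {n} G = ∀ (u v : Fin n) → Walk G u v

closedNbhdSum : ∀ {n} → Graph n → (Fin n → ℕ) → Fin n → ℕ
closedNbhdSum G f v = f v + Σv (λ w → if adj G v w then f w else 0)

activeNbrs : ∀ {n} → Graph n → (Fin n → ℕ) → Fin n → ℕ
activeNbrs G f v = Σv (λ w → if adj G v w then (isPos (f w)) else 0)
  where
  isPos : ℕ → ℕ
  isPos zero = 0
  isPos (suc _) = 1

IsKRDF : ∀ {n} → ℕ → Graph n → (Fin n → ℕ) → Set
IsKRDF {n} k G f =
  (∀ v → f v ≤ suc k) ×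
  (∀ v → f v < k → k + activeNbrs G f v ≤ closedNbhdSum G f v)

PosIndependent : ∀ {n} → Graph n → (Fin n → ℕ) → Set
PosIndependent {n} G f =
  ∀ (u v : Fin n) → 1 ≤ f u → 1 ≤ f v → adj G u v ≡ false

weight : ∀ {n} → (Fin n → ℕ) → ℕ
weight f = Σv f

IsIndepKRomanNumber : ∀ {n} → ℕ → Graph n → ℕ → Set
IsIndepKRomanNumber {n} k G m =
  (Σ (Fin n → ℕ) λ f → IsKRDF k G f × PosIndependent G f × weight f ≡ m) ×
  (∀ f → IsKRDF k G f → PosIndependent G f → m ≤ weight f)

-- An unlabelled vertex v satisfies f(N[v]) ≥ k + |AN(v)|, that is k ≤ Σ_{w ∈ N(v)} (f(w) − 1),
-- and a labelled vertex trivially has k ≤ k·1. Summing over all vertices and double counting the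
-- edges gives k·n ≤ k·P + Δ·E, where P is the number of labelled vertices and E = Σ_w (f(w) − 1) is
-- the total excess, so that f(V) = P + E. No label exceeds k + 1, hence E ≤ k·P, and together with
-- k ≤ Δ the two inequalities yield k(k+1)n ≤ k(Δ+1)f(V).
module Submission where

open import Defs hiding (sym)
open import Data.Nat using (ℕ; zero; suc; _+_; _*_; _∸_; _⊓_; _≤_; _<_; z≤n; s≤s⁻¹; >-nonZero)
open import Data.Nat.Properties
open import Data.Nat.ListAction using () renaming (sum to sumᴸ)
open import Data.Nat.Tactic.RingSolver using (solve)
open import Data.Bool using (true; false; if_then_else_)
open import Data.Fin using (Fin; zero; suc)
open import Data.List using ([]; _∷_; tabulate)
open import Data.List.Properties using (map-tabulate)
open import Data.Product using (_,_; proj₁; proj₂)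
open import Function using (id; _∘_)
open import Relation.Binary.PropositionalEquality
open import Algebra.Properties.Semiring.Sum +-*-semiring
  using (sum-syntax; sum-cong-≗; ∑-distrib-+; ∑-comm; *-distribˡ-sum; *-distribʳ-sum)

sumᴸ-tabulate : ∀ {n} (g : Fin n → ℕ) → sumᴸ (tabulate g) ≡ ∑[ i < n ] g i
sumᴸ-tabulate {zero}  g = refl
sumᴸ-tabulate {suc n} g = cong (g zero +_) (sumᴸ-tabulate (g ∘ suc))

Σv≡∑ : ∀ {n} (g : Fin n → ℕ) → Σv g ≡ ∑[ i < n ] g i
Σv≡∑ g = trans (cong sumᴸ (map-tabulate id g)) (sumᴸ-tabulate g)

∑-mono-≤ : ∀ {n} {g h : Fin n → ℕ} → (∀ i → g i ≤ h i) → ∑[ i < n ] g i ≤ ∑[ i < n ] h i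
∑-mono-≤ {zero}  g≤h = z≤n
∑-mono-≤ {suc n} g≤h = +-mono-≤ (g≤h zero) (∑-mono-≤ (g≤h ∘ suc))

∑-const : ∀ n c → ∑[ i < n ] c ≡ n * c
∑-const zero    c = refl
∑-const (suc n) c = cong (c +_) (∑-const n c)

nbrSum : ∀ {n} → Graph n → Fin n → (Fin n → ℕ) → ℕ
nbrSum {n} G v g = ∑[ w < n ] (if adj G v w then g w else 0)

if-then-+ : ∀ b {x y : ℕ} → (if b then x + y else 0) ≡ (if b then x else 0) + (if b then y else 0)
if-then-+ true  = refl
if-then-+ false = refl

nbrSum-distrib-+ : ∀ {n} (G : Graph n) v (g h : Fin n → ℕ) →
  nbrSum G v (λ w → g w + h w) ≡ nbrSum G v g + nbrSum G v h
nbrSum-distrib-+ {n} G v g h = trans (sum-cong-≗ {n} (λ w → if-then-+ (adj G v w))) (∑-distrib-+ {n} _ _)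

∑-nbrSum≡∑-deg* : ∀ {n} (G : Graph n) (h : Fin n → ℕ) →
  ∑[ v < n ] nbrSum G v h ≡ ∑[ w < n ] (deg G w * h w)
∑-nbrSum≡∑-deg* {n} G h = begin
  ∑[ v < n ] ∑[ w < n ] (if adj G v w then h w else 0)
    ≡⟨ ∑-comm {n} {n} _ ⟩
  ∑[ w < n ] ∑[ v < n ] (if adj G v w then h w else 0)
    ≡⟨ sum-cong-≗ {n} (λ w → sum-cong-≗ {n} (edge-term w)) ⟩
  ∑[ w < n ] ∑[ v < n ] ((if adj G w v then 1 else 0) * h w)
    ≡⟨ sum-cong-≗ {n} (λ w → *-distribʳ-sum {n} (h w) _) ⟨
  ∑[ w < n ] ((∑[ v < n ] (if adj G w v then 1 else 0)) * h w)
    ≡⟨ sum-cong-≗ {n} (λ w → cong (_* h w) (Σv≡∑ {n} _)) ⟨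
  ∑[ w < n ] (deg G w * h w)
    ∎
  where
  open ≡-Reasoning
  edge-term : ∀ w v → (if adj G v w then h w else 0) ≡ (if adj G w v then 1 else 0) * h w
  edge-term w v rewrite Graph.sym G v w with adj G w v
  ... | true  = sym (+-identityʳ (h w))
  ... | false = refl

∑-nbrSum≤ : ∀ {n} (G : Graph n) {D} → (∀ w → deg G w ≤ D) → (h : Fin n → ℕ) →
  ∑[ v < n ] nbrSum G v h ≤ D * ∑[ w < n ] h w
∑-nbrSum≤ {n} G {D} deg≤D h = begin
  ∑[ v < n ] nbrSum G v h    ≡⟨ ∑-nbrSum≡∑-deg* G h ⟩
  ∑[ w < n ] (deg G w * h w) ≤⟨ ∑-mono-≤ {n} (λ w → *-monoˡ-≤ (h w) (deg≤D w)) ⟩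
  ∑[ w < n ] (D * h w)       ≡⟨ *-distribˡ-sum {n} D h ⟨
  D * ∑[ w < n ] h w         ∎
  where open ≤-Reasoning

-- activeNbrs tests positivity with a function local to Defs, which cannot be named here; the
-- left-hand side of activeSummand≡ is therefore left to unification with the unfolded activeNbrs.
mutual
  activeNbrs≡ : ∀ {n} (G : Graph n) f v → activeNbrs G f v ≡ nbrSum G v (λ w → 1 ⊓ f w)
  activeNbrs≡ {n} G f v = trans (Σv≡∑ {n} _) (sum-cong-≗ {n} (activeSummand≡ G f v))

  activeSummand≡ : ∀ {n} (G : Graph n) f v w → _ ≡ (if adj G v w then 1 ⊓ f w else 0)
  activeSummand≡ G f v w with f w
  ... | zero  = refl
  ... | suc _ = refl

excess : ∀ {n} → Graph n → (Fin n → ℕ) → Fin n → ℕ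
excess G f v = nbrSum G v (λ w → f w ∸ 1)

nbrSum≡activeNbrs+excess : ∀ {n} (G : Graph n) f v → nbrSum G v f ≡ activeNbrs G f v + excess G f v
nbrSum≡activeNbrs+excess {n} G f v = begin
  nbrSum G v f
    ≡⟨ sum-cong-≗ {n} (λ w → cong (if adj G v w then_else 0) (m⊓n+n∸m≡n 1 (f w))) ⟨
  nbrSum G v (λ w → 1 ⊓ f w + (f w ∸ 1))        ≡⟨ nbrSum-distrib-+ G v _ _ ⟩
  nbrSum G v (λ w → 1 ⊓ f w) + excess G f v     ≡⟨ cong (_+ excess G f v) (activeNbrs≡ G f v) ⟨
  activeNbrs G f v + excess G f v               ∎
  where open ≡-Reasoning

module _ {n k} (G : Graph n) (f : Fin n → ℕ) (isKRDF : IsKRDF k G f) where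

  k≤label+excess : ∀ v → f v < k → k ≤ f v + excess G f v
  k≤label+excess v fv<k = +-cancelʳ-≤ a k (f v + e) (begin
    k + a                 ≤⟨ proj₂ isKRDF v fv<k ⟩
    closedNbhdSum G f v   ≡⟨ cong (f v +_) (trans (Σv≡∑ {n} _) (nbrSum≡activeNbrs+excess G f v)) ⟩
    f v + (a + e)         ≡⟨ cong (f v +_) (+-comm a e) ⟩
    f v + (e + a)         ≡⟨ +-assoc (f v) e a ⟨
    f v + e + a           ∎)
    where
    open ≤-Reasoning
    a = activeNbrs G f v
    e = excess G f v

  k≤positive*k+excess : 1 ≤ k → ∀ v → k ≤ (1 ⊓ f v) * k + excess G f v
  k≤positive*k+excess k≥1 v with f v in fv≡
  ... | zero  = subst (λ x → k ≤ x + excess G f v) fv≡ (k≤label+excess v (subst (_< k) (sym fv≡) k≥1))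
  ... | suc _ = m≤n⇒m≤n+o (excess G f v) (m≤m+n k 0)

pred≤positive*k : ∀ {k} x → x ≤ suc k → x ∸ 1 ≤ (1 ⊓ x) * k
pred≤positive*k zero    _      = z≤n
pred≤positive*k (suc x) x<1+k = m≤n⇒m≤n+o 0 (s≤s⁻¹ x<1+k)

weighted-slack : ∀ k d P E → E ≤ P * k →
  (k + 1) * (P * k + (k + d) * E) ≤ k * ((P + E) * (k + d + 1))
weighted-slack k d P E E≤Pk = +-cancelʳ-≤ (d * E) _ _ (begin
  (k + 1) * (P * k + (k + d) * E) + d * E       ≤⟨ +-monoʳ-≤ _ (*-monoʳ-≤ d E≤Pk) ⟩
  (k + 1) * (P * k + (k + d) * E) + d * (P * k) ≡⟨ solve (k ∷ d ∷ P ∷ E ∷ []) ⟩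
  k * ((P + E) * (k + d + 1)) + d * E           ∎)
  where open ≤-Reasoning

counting-bound : ∀ {k D} n P E → 1 ≤ k → k ≤ D →
  n * k ≤ P * k + D * E → E ≤ P * k → n * (k + 1) ≤ (P + E) * (D + 1)
counting-bound {k} {D} n P E k≥1 k≤D covering E≤Pk
  with d , refl ← m≤n⇒∃[o]m+o≡n k≤D = *-cancelˡ-≤ k {{>-nonZero k≥1}} (begin
    k * (n * (k + 1))               ≡⟨ solve (k ∷ n ∷ []) ⟩
    (k + 1) * (n * k)               ≤⟨ *-monoʳ-≤ (k + 1) covering ⟩
    (k + 1) * (P * k + (k + d) * E) ≤⟨ weighted-slack k d P E E≤Pk ⟩
    k * ((P + E) * (k + d + 1))     ∎)
  where open ≤-Reasoning

kRDF-weight-bound : ∀ {n k D} (G : Graph n) (f : Fin n → ℕ) → IsKRDF k G f →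
  1 ≤ k → k ≤ D → (∀ v → deg G v ≤ D) → n * (k + 1) ≤ weight f * (D + 1)
kRDF-weight-bound {n} {k} {D} G f isKRDF k≥1 k≤D deg≤D =
  subst (λ W → n * (k + 1) ≤ W * (D + 1)) (sym weight≡P+E) (counting-bound n P E k≥1 k≤D covering E≤P*k)
  where
  P E : ℕ
  P = ∑[ v < n ] (1 ⊓ f v)
  E = ∑[ v < n ] (f v ∸ 1)

  weight≡P+E : weight f ≡ P + E
  weight≡P+E = begin
    weight f                             ≡⟨ Σv≡∑ f ⟩
    ∑[ v < n ] f v                       ≡⟨ sum-cong-≗ {n} (λ v → m⊓n+n∸m≡n 1 (f v)) ⟨
    ∑[ v < n ] (1 ⊓ f v + (f v ∸ 1))     ≡⟨ ∑-distrib-+ {n} _ _ ⟩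
    P + E                                ∎
    where open ≡-Reasoning

  covering : n * k ≤ P * k + D * E
  covering = begin
    n * k                                                  ≡⟨ ∑-const n k ⟨
    ∑[ v < n ] k                                           ≤⟨ ∑-mono-≤ {n} (k≤positive*k+excess G f isKRDF k≥1) ⟩
    ∑[ v < n ] ((1 ⊓ f v) * k + excess G f v)              ≡⟨ ∑-distrib-+ {n} _ _ ⟩
    ∑[ v < n ] ((1 ⊓ f v) * k) + ∑[ v < n ] excess G f v   ≡⟨ cong (_+ _) (*-distribʳ-sum {n} k _) ⟨
    P * k + ∑[ v < n ] excess G f v                        ≤⟨ +-monoʳ-≤ (P * k) (∑-nbrSum≤ G deg≤D _) ⟩
    P * k + D * E                                          ∎
    where open ≤-Reasoning

  E≤P*k : E ≤ P * k
  E≤P*k = begin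
    E                           ≤⟨ ∑-mono-≤ {n} (λ v → pred≤positive*k (f v) (proj₁ isKRDF v)) ⟩
    ∑[ v < n ] ((1 ⊓ f v) * k)  ≡⟨ *-distribʳ-sum {n} k _ ⟨
    P * k                       ∎
    where open ≤-Reasoning

corollary3p4 : (k n : ℕ) → 1 ≤ k → 2 ≤ n → (G : Graph n) → Connected G →
    (D : ℕ) → IsMaxDegree G D → k ≤ D →
    (m : ℕ) → IsIndepKRomanNumber k G m →
    n * (k + 1) ≤ m * (D + 1)
corollary3p4 k n k≥1 _ G _ D (deg≤D , _) k≤D m ((f , isKRDF , _ , weight≡m) , _) =
  subst (λ W → n * (k + 1) ≤ W * (D + 1)) weight≡m (kRDF-weight-bound G f isKRDF k≥1 k≤D deg≤D)
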